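{- Let $s,r \geq 2$ be integers. Then \[ \operatorname{BR}^2(\diamond_s,\vee_r) \leq \operatorname{BR}^2(\wedge_{s+r},\vee_r) \leq \left\lceil\log_{3/2}(2r+s-1) \right\rceil. \]
   Context: 2-uniform pographs: $\vee_r$ (the $r$-cup) has poset $\{x,y_1,\dots,y_r\}$ with $x\le y_i$ and edges $xy_i$; $\wedge_r$ (the $r$-cap) has poset $\{y,x_1,\dots,x_r\}$ with $x_i\le y$ and edges $x_iy$; $\diamond_s$ (the $s$-diamond) has poset $\{x,y_1,\dots,y_s,z\}$ with $x\le y_i\le z$ and edges $xy_i,y_iz$. Given a coloring of the comparable pairs of a poset $Q$, a copy of $H$ in color $i$ is an injection $f:V(H)\to Q$ with $f(x)\le f(y)$ whenever $x\le y$ such that every edge of $H$ is mapped to a pair of color $i$. $\operatorname{BR}^2(G_1,G_2)$ is the least $N$ such that every 2-coloring of the comparable pairs of the Boolean lattice $B_N$ (subsets of $[N]$) contains a copy of $G_1$ in color 1 or a copy of $G_2$ in color 2. -}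

module Defs where

open import Data.Nat using (ℕ; zero; suc; _+_; _*_; _^_; _≤_; _<_)
open import Data.Fin using (Fin)
open import Data.Fin.Subset using (Subset; _⊆_)
open import Data.Unit using (⊤)
open import Data.Empty using (⊥)
open import Data.Product using (Σ; _×_)
open import Data.Sum using (_⊎_)
open import Relation.Binary.PropositionalEquality using (_≡_)
open import Function.Definitions using (Injective)

-- A 2-uniform pograph: a poset on V (given by its strict order _≺_;
-- reflexive pairs impose nothing on a copy) together with a set of edges,
-- each edge being an ordered comparable pair (lower, upper).
record Pograph : Set₁ where
  field
    V    : Set
    _≺_  : V → V → Set
    edge : V → V → Set

data CupV (r : ℕ) : Set where
  low : CupV r
  up  : Fin r → CupV r

cupRel : ∀ {r} → CupV r → CupV r → Set
cupRel low (up _) = ⊤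
cupRel _   _      = ⊥

cup : ℕ → Pograph
cup r = record { V = CupV r ; _≺_ = cupRel ; edge = cupRel }

data CapV (r : ℕ) : Set where
  top : CapV r
  bot : Fin r → CapV r

capRel : ∀ {r} → CapV r → CapV r → Set
capRel (bot _) top = ⊤
capRel _       _   = ⊥

cap : ℕ → Pograph
cap r = record { V = CapV r ; _≺_ = capRel ; edge = capRel }

data DiaV (s : ℕ) : Set where
  dbot : DiaV s
  dmid : Fin s → DiaV s
  dtop : DiaV s

diaOrd : ∀ {s} → DiaV s → DiaV s → Set
diaOrd dbot     (dmid _) = ⊤
diaOrd (dmid _) dtop     = ⊤
diaOrd dbot     dtop     = ⊤
diaOrd _        _        = ⊥

diaEdge : ∀ {s} → DiaV s → DiaV s → Set
diaEdge dbot     (dmid _) = ⊤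
diaEdge (dmid _) dtop     = ⊤
diaEdge _        _        = ⊥

diamond : ℕ → Pograph
diamond s = record { V = DiaV s ; _≺_ = diaOrd ; edge = diaEdge }

-- Given as a function on all ordered pairs; only values on pairs A ⊊ B are
-- ever inspected (edges of a copy map to distinct comparable pairs).
Colouring : ℕ → Set
Colouring N = Subset N → Subset N → Fin 2

Copy : ∀ {N} → Pograph → Colouring N → Fin 2 → Set
Copy {N} H c i =
  Σ (V → Subset N) λ f →
    Injective _≡_ _≡_ f
    × (∀ x y → x ≺ y → f x ⊆ f y)
    × (∀ x y → edge x y → c (f x) (f y) ≡ i)
  where open Pograph H

-- Every 2-colouring of B_N contains G1 in colour 1 or G2 in colour 2
-- (colours 1,2 are Fin.zero, Fin.suc Fin.zero).
Arrows : Pograph → Pograph → ℕ → Set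
Arrows G₁ G₂ N = (c : Colouring N) → Copy G₁ c Fin.zero ⊎ Copy G₂ c (Fin.suc Fin.zero)

-- k = ⌈ log_{3/2} m ⌉  (for m ≥ 1): least k with (3/2)^k ≥ m, i.e. m·2^k ≤ 3^k.
IsCeilLog32 : ℕ → ℕ → Set
IsCeilLog32 m k = (m * 2 ^ k ≤ 3 ^ k) × (∀ j → j < k → 3 ^ j < m * 2 ^ j)

-- A red (s+r)-cap with top y has at most one bottom equal to ∅.  Among the pairs ∅ ⊂ x
-- for the other s+r−1 bottoms x there are either r blue ones, a blue r-cup at ∅, or
-- s red ones, which with the red edges x ⊂ y form a red s-diamond ∅ ⊂ x ⊂ y.
--
-- For the upper bound count the 3^L − 2^L strict pairs of B_L.  If no set is the
-- top of s+r red pairs (at most s+r−1 each, and none for ∅) and no set is the bottom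
-- of r blue pairs, there are at most (s+r−1)(2^L − 1) + (r−1)·2^L strict pairs,
-- which is less than 3^L − 2^L as soon as (2r+s−1)·2^L ≤ 3^L.

module Submission where

open import Defs
open import Data.Nat using (ℕ; _+_; _*_; _∸_; _≤_)
open import Data.Product using (Σ; _×_)

open import Data.Bool using (true; false; if_then_else_)
open import Data.Fin using (Fin; zero; suc; inject≤; fromℕ<)
open import Data.Fin.Properties using (inject≤-injective; _≟_)
open import Data.Fin.Subset using (Subset; outside; inside; _⊆_; _⊂_; ⊥)
open import Data.Fin.Subset.Properties
  using (_⊆?_; _⊂?_; ⊂-irref; s⊂s; out⊂in; drop-∷-⊆; ⊆-⊂-trans; ⊥⊆; ∉⊥; Empty-unique)
open import Data.List using (List; []; _∷_; _++_; map; length; filter; lookup; allFin)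
open import Data.List.Properties using (map-++; map-∘; length-++; length-map; length-tabulate)
open import Data.List.Membership.Propositional using (_∈_)
open import Data.List.Membership.Propositional.Properties
  using (∈-lookup; ∈-filter⁻; ∈-map⁺; ∈-map⁻; ∈-++⁺ˡ; ∈-++⁺ʳ)
open import Data.List.Relation.Unary.All as All using (All; []; _∷_)
open import Data.List.Relation.Unary.All.Properties using (¬All⇒Any¬)
open import Data.List.Relation.Unary.AllPairs using ([]; _∷_)
open import Data.List.Relation.Unary.Any using (here; there; satisfied)
open import Data.List.Relation.Unary.Unique.Propositional using (Unique)
import Data.List.Relation.Unary.Unique.Propositional.Properties as Unique
open import Data.Nat using (zero; suc; _^_; _<_; z≤n; z<s; s≤s; s<s; _≤?_)
open import Data.Nat.ListAction using (sum)
open import Data.Nat.ListAction.Properties using (sum-++)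
open import Data.Nat.Properties
  using ( +-assoc; +-comm; +-identityʳ; +-suc; *-suc; *-zeroʳ; *-distribʳ-+
        ; ≤-refl; ≤-reflexive; ≤-trans; <-≤-trans; ≤-pred; ≰⇒>; <⇒≱; <⇒≢
        ; +-mono-≤; +-monoˡ-≤; +-monoʳ-≤; +-monoʳ-<; m<m+n; m≤n+m; n<1+n
        ; +-commutativeSemigroup; module ≤-Reasoning)
open import Algebra.Properties.CommutativeSemigroup +-commutativeSemigroup
  using () renaming (interchange to +-interchange)
open import Data.Nat.Solver using (module +-*-Solver)
open import Data.Product using (∃; _,_; proj₁; proj₂; map₂)
open import Data.Sum using (_⊎_; inj₁; inj₂; [_,_]′)
open import Data.Vec using ([]; _∷_; here)
open import Data.Vec.Properties using (∷-injectiveʳ)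
import Function.Construct.Composition as Composition
open import Function.Base using (_∘_)
open import Function.Definitions using (Injective)
open import Level using (Level)
open import Relation.Binary.PropositionalEquality
open import Relation.Nullary using (Dec; does; yes; no; ¬_; contradiction; _×-dec_)
open import Relation.Nullary.Decidable using (dec-false)
open import Relation.Unary using (Pred; Decidable)
open import Relation.Unary.Properties using (∁?)

open +-*-Solver using (solve; _:+_; _:=_; con)

private
  variable
    a ℓ : Level
    A B : Set a
    xs : List A

χ : {P : Set ℓ} → Dec P → ℕ
χ d = if does d then 1 else 0

∑ : List A → (A → ℕ) → ℕ
∑ xs f = sum (map f xs)

count : {P : Pred A ℓ} → Decidable P → List A → ℕ
count P? xs = ∑ xs (λ x → χ (P? x))

∑-++ : ∀ (xs ys : List A) f → ∑ (xs ++ ys) f ≡ ∑ xs f + ∑ ys f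
∑-++ xs ys f = trans (cong sum (map-++ f xs ys)) (sum-++ (map f xs) (map f ys))

∑-map : ∀ (g : A → B) (xs : List A) f → ∑ (map g xs) f ≡ ∑ xs (f ∘ g)
∑-map g xs f = cong sum (sym (map-∘ xs))

∑-cong : ∀ (xs : List A) {f g} → (∀ x → f x ≡ g x) → ∑ xs f ≡ ∑ xs g
∑-cong []       f≗g = refl
∑-cong (x ∷ xs) f≗g = cong₂ _+_ (f≗g x) (∑-cong xs f≗g)

∑-zero : ∀ (xs : List A) → ∑ xs (λ _ → 0) ≡ 0
∑-zero []       = refl
∑-zero (x ∷ xs) = ∑-zero xs

∑-distrib-+ : ∀ (xs : List A) f g → ∑ xs (λ x → f x + g x) ≡ ∑ xs f + ∑ xs g
∑-distrib-+ []       f g = refl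
∑-distrib-+ (x ∷ xs) f g =
  trans (cong ((f x + g x) +_) (∑-distrib-+ xs f g)) (+-interchange (f x) (g x) _ _)

∑-comm : ∀ (xs : List A) (ys : List B) (h : A → B → ℕ) →
         ∑ xs (λ x → ∑ ys (h x)) ≡ ∑ ys (λ y → ∑ xs (λ x → h x y))
∑-comm []       ys h = sym (∑-zero ys)
∑-comm (x ∷ xs) ys h = begin
  ∑ ys (h x) + ∑ xs (λ x → ∑ ys (h x))               ≡⟨ cong (∑ ys (h x) +_) (∑-comm xs ys h) ⟩
  ∑ ys (h x) + ∑ ys (λ y → ∑ xs (λ x → h x y))       ≡⟨ sym (∑-distrib-+ ys (h x) _) ⟩
  ∑ ys (λ y → h x y + ∑ xs (λ x → h x y))            ∎
  where open ≡-Reasoning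

∑-≤ : ∀ {f : A → ℕ} {k} {xs} → All (λ x → f x ≤ k) xs → ∑ xs f ≤ k * length xs
∑-≤ {k = k} []                     = ≤-reflexive (sym (*-zeroʳ k))
∑-≤ {k = k} {_ ∷ xs} (fx≤k ∷ f≤k) = begin
  _ + ∑ xs _       ≤⟨ +-mono-≤ fx≤k (∑-≤ f≤k) ⟩
  k + k * length xs ≡⟨ *-suc k (length xs) ⟨
  k * suc (length xs) ∎
  where open ≤-Reasoning

∑-≤-vanishing : ∀ {f : A → ℕ} {k x₀ xs} → x₀ ∈ xs → f x₀ ≡ 0 →
                All (λ x → f x ≤ k) xs → ∑ xs f + k ≤ k * length xs
∑-≤-vanishing {f = f} {k} {xs = _ ∷ xs} (here refl) fx₀≡0 (_ ∷ f≤k) = begin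
  f _ + ∑ xs f + k      ≡⟨ cong (λ y → y + ∑ xs f + k) fx₀≡0 ⟩
  ∑ xs f + k            ≤⟨ +-monoˡ-≤ k (∑-≤ f≤k) ⟩
  k * length xs + k     ≡⟨ +-comm (k * length xs) k ⟩
  k + k * length xs     ≡⟨ *-suc k (length xs) ⟨
  k * suc (length xs)   ∎
  where open ≤-Reasoning
∑-≤-vanishing {f = f} {k} {xs = x ∷ xs} (there x₀∈xs) fx₀≡0 (fx≤k ∷ f≤k) = begin
  f x + ∑ xs f + k      ≡⟨ +-assoc (f x) (∑ xs f) k ⟩
  f x + (∑ xs f + k)    ≤⟨ +-mono-≤ fx≤k (∑-≤-vanishing x₀∈xs fx₀≡0 f≤k) ⟩
  k + k * length xs     ≡⟨ *-suc k (length xs) ⟨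
  k * suc (length xs)   ∎
  where open ≤-Reasoning

¬All≤⇒∃> : ∀ (f : A → ℕ) k xs → ¬ All (λ x → f x ≤ k) xs → ∃ λ x → k < f x
¬All≤⇒∃> f k xs ¬f≤k = map₂ ≰⇒> (satisfied (¬All⇒Any¬ (λ x → f x ≤? k) xs ¬f≤k))

lookup-injective : Unique xs → Injective _≡_ _≡_ (lookup xs)
lookup-injective {xs = _ ∷ _} _         {zero}  {zero}  _  = refl
lookup-injective {xs = _ ∷ _} (x∉ ∷ _)  {zero}  {suc j} eq = contradiction eq (All.lookup x∉ (∈-lookup j))
lookup-injective {xs = _ ∷ _} (x∉ ∷ _)  {suc i} {zero}  eq = contradiction (sym eq) (All.lookup x∉ (∈-lookup i))
lookup-injective {xs = _ ∷ _} (_ ∷ xs!) {suc i} {suc j} eq = cong suc (lookup-injective xs! eq)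

module _ {P : Pred A ℓ} (P? : Decidable P) where

  count≡length∘filter : ∀ xs → count P? xs ≡ length (filter P? xs)
  count≡length∘filter []       = refl
  count≡length∘filter (x ∷ xs) with does (P? x)
  ... | true  = cong suc (count≡length∘filter xs)
  ... | false = count≡length∘filter xs

  count-none : ∀ xs → (∀ x → ¬ P x) → count P? xs ≡ 0
  count-none []       ¬P = refl
  count-none (x ∷ xs) ¬P rewrite dec-false (P? x) (¬P x) = count-none xs ¬P

  count+count-∁ : ∀ xs → count P? xs + count (∁? P?) xs ≡ length xs
  count+count-∁ []       = refl
  count+count-∁ (x ∷ xs) with does (P? x)
  ... | true  = cong suc (count+count-∁ xs)
  ... | false = trans (+-suc (count P? xs) _) (cong suc (count+count-∁ xs))

  count-by-colour : ∀ (colour : A → Fin 2) xs →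
    count P? xs ≡ count (λ x → P? x ×-dec colour x ≟ zero) xs
                + count (λ x → P? x ×-dec colour x ≟ suc zero) xs
  count-by-colour colour []       = refl
  count-by-colour colour (x ∷ xs) with does (P? x) | colour x
  ... | false | _           = count-by-colour colour xs
  ... | true  | zero        = cong suc (count-by-colour colour xs)
  ... | true  | suc zero    = trans (cong suc (count-by-colour colour xs)) (sym (+-suc _ _))

  count⇒injection : ∀ {m xs} → Unique xs → m ≤ count P? xs →
                    Σ (Fin m → A) λ e → Injective _≡_ _≡_ e × (∀ i → P (e i))
  count⇒injection {m} {xs} xs! m≤count = e , e-injective , P∘e
    where
    ys = filter P? xs
    m≤|ys| : m ≤ length ys
    m≤|ys| = subst (m ≤_) (count≡length∘filter xs) m≤count
    e : Fin m → A
    e i = lookup ys (inject≤ i m≤|ys|)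
    e-injective : Injective _≡_ _≡_ e
    e-injective = inject≤-injective _ _ _ _ ∘ lookup-injective (Unique.filter⁺ P? xs!)
    P∘e : ∀ i → P (e i)
    P∘e i = proj₂ (∈-filter⁻ P? {xs = xs} (∈-lookup (inject≤ i m≤|ys|)))

  count≤1 : ∀ {xs} → Unique xs → (∀ {x y} → P x → P y → x ≡ y) → count P? xs ≤ 1
  count≤1 {xs} xs! P-unique with 2 ≤? count P? xs
  ... | no  2≰count = ≤-pred (≰⇒> 2≰count)
  ... | yes 2≤count with count⇒injection xs! 2≤count
  ...   | e , e-injective , P∘e with e-injective (P-unique (P∘e zero) (P∘e (suc zero)))
  ...     | ()

subsets : ∀ n → List (Subset n)
subsets zero    = [] ∷ []
subsets (suc n) = map (outside ∷_) (subsets n) ++ map (inside ∷_) (subsets n)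

subsets-unique : ∀ n → Unique (subsets n)
subsets-unique zero    = [] ∷ []
subsets-unique (suc n) = Unique.++⁺ (Unique.map⁺ ∷-injectiveʳ (subsets-unique n))
                                    (Unique.map⁺ ∷-injectiveʳ (subsets-unique n))
                                    outside-inside-disjoint
  where
  outside-inside-disjoint : ∀ {p} → ¬ (p ∈ map (outside ∷_) (subsets n) × p ∈ map (inside ∷_) (subsets n))
  outside-inside-disjoint (p∈outside , p∈inside) with ∈-map⁻ _ p∈outside | ∈-map⁻ _ p∈inside
  ... | _ , _ , refl | _ , _ , ()

∈-subsets : ∀ {n} (p : Subset n) → p ∈ subsets n
∈-subsets []            = here refl
∈-subsets (outside ∷ p) = ∈-++⁺ˡ (∈-map⁺ (outside ∷_) (∈-subsets p))
∈-subsets (inside ∷ p)  = ∈-++⁺ʳ _ (∈-map⁺ (inside ∷_) (∈-subsets p))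

length-subsets : ∀ n → length (subsets n) ≡ 2 ^ n
length-subsets zero    = refl
length-subsets (suc n) = begin
  length (map (outside ∷_) (subsets n) ++ map (inside ∷_) (subsets n))
    ≡⟨ length-++ (map (outside ∷_) (subsets n)) ⟩
  length (map (outside ∷_) (subsets n)) + length (map (inside ∷_) (subsets n))
    ≡⟨ cong₂ _+_ (length-map _ (subsets n)) (length-map _ (subsets n)) ⟩
  length (subsets n) + length (subsets n)
    ≡⟨ cong (λ l → l + l) (length-subsets n) ⟩
  2 ^ n + 2 ^ n
    ≡⟨ cong (2 ^ n +_) (+-identityʳ (2 ^ n)) ⟨
  2 ^ suc n ∎
  where open ≡-Reasoning

∑-subsets-suc : ∀ n (f : Subset (suc n) → ℕ) →
  ∑ (subsets (suc n)) f ≡ ∑ (subsets n) (f ∘ (outside ∷_)) + ∑ (subsets n) (f ∘ (inside ∷_))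
∑-subsets-suc n f = trans (∑-++ (map (outside ∷_) (subsets n)) _ f)
                          (cong₂ _+_ (∑-map _ (subsets n) f) (∑-map _ (subsets n) f))

-- Dec.map in the definitions of _⊆?_ and _⊂?_ preserves `does`, so once the sum is split
-- these recurrences hold by computation.
module _ {n} (q : Subset n) where

  count-⊆-outside : count (_⊆? outside ∷ q) (subsets (suc n)) ≡ count (_⊆? q) (subsets n)
  count-⊆-outside = trans (∑-subsets-suc n _) (trans (cong (count (_⊆? q) (subsets n) +_) (∑-zero (subsets n)))
                                                     (+-identityʳ _))

  count-⊆-inside : count (_⊆? inside ∷ q) (subsets (suc n)) ≡ count (_⊆? q) (subsets n) + count (_⊆? q) (subsets n)
  count-⊆-inside = ∑-subsets-suc n _

  count-⊂-outside : count (_⊂? outside ∷ q) (subsets (suc n)) ≡ count (_⊂? q) (subsets n)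
  count-⊂-outside = trans (∑-subsets-suc n _) (trans (cong (count (_⊂? q) (subsets n) +_) (∑-zero (subsets n)))
                                                     (+-identityʳ _))

  count-⊂-inside : count (_⊂? inside ∷ q) (subsets (suc n)) ≡ count (_⊆? q) (subsets n) + count (_⊂? q) (subsets n)
  count-⊂-inside = ∑-subsets-suc n _

∑-count-⊆ : ∀ n → ∑ (subsets n) (λ q → count (_⊆? q) (subsets n)) ≡ 3 ^ n
∑-count-⊆ zero    = refl
∑-count-⊆ (suc n) = begin
  ∑ (subsets (suc n)) (λ q → count (_⊆? q) (subsets (suc n)))
    ≡⟨ ∑-subsets-suc n _ ⟩
  ∑ (subsets n) (λ q → count (_⊆? outside ∷ q) (subsets (suc n)))
    + ∑ (subsets n) (λ q → count (_⊆? inside ∷ q) (subsets (suc n)))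
    ≡⟨ cong₂ _+_ (∑-cong (subsets n) count-⊆-outside)
                 (trans (∑-cong (subsets n) count-⊆-inside) (∑-distrib-+ (subsets n) _ _)) ⟩
  T + (T + T)
    ≡⟨ cong (λ t → t + (t + t)) (∑-count-⊆ n) ⟩
  3 ^ n + (3 ^ n + 3 ^ n)
    ≡⟨ cong (λ t → 3 ^ n + (3 ^ n + t)) (+-identityʳ (3 ^ n)) ⟨
  3 ^ suc n ∎
  where
  open ≡-Reasoning
  T = ∑ (subsets n) (λ q → count (_⊆? q) (subsets n))

∑-count-⊂ : ∀ n → ∑ (subsets n) (λ q → count (_⊂? q) (subsets n)) + 2 ^ n ≡ 3 ^ n
∑-count-⊂ zero    = refl
∑-count-⊂ (suc n) = begin
  ∑ (subsets (suc n)) (λ q → count (_⊂? q) (subsets (suc n))) + 2 ^ suc n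
    ≡⟨ cong (_+ 2 ^ suc n) (∑-subsets-suc n _) ⟩
  ∑ (subsets n) (λ q → count (_⊂? outside ∷ q) (subsets (suc n)))
    + ∑ (subsets n) (λ q → count (_⊂? inside ∷ q) (subsets (suc n))) + 2 ^ suc n
    ≡⟨ cong (_+ 2 ^ suc n) (cong₂ _+_ (∑-cong (subsets n) count-⊂-outside)
                 (trans (∑-cong (subsets n) count-⊂-inside) (∑-distrib-+ (subsets n) _ _))) ⟩
  S + (T + S) + 2 ^ suc n
    ≡⟨ solve 3 (λ s t p → s :+ (t :+ s) :+ (p :+ (p :+ con 0)) := t :+ ((s :+ p) :+ (s :+ p))) refl S T (2 ^ n) ⟩
  T + ((S + 2 ^ n) + (S + 2 ^ n))
    ≡⟨ cong₂ (λ t u → t + (u + u)) (∑-count-⊆ n) (∑-count-⊂ n) ⟩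
  3 ^ n + (3 ^ n + 3 ^ n)
    ≡⟨ cong (λ t → 3 ^ n + (3 ^ n + t)) (+-identityʳ (3 ^ n)) ⟨
  3 ^ suc n ∎
  where
  open ≡-Reasoning
  S = ∑ (subsets n) (λ q → count (_⊂? q) (subsets n))
  T = ∑ (subsets n) (λ q → count (_⊆? q) (subsets n))

⊆∧≢⇒⊂ : ∀ {n} {p q : Subset n} → p ⊆ q → p ≢ q → p ⊂ q
⊆∧≢⇒⊂ {p = []}          {[]}          _   p≢q = contradiction refl p≢q
⊆∧≢⇒⊂ {p = outside ∷ p} {outside ∷ q} p⊆q p≢q = s⊂s (⊆∧≢⇒⊂ (drop-∷-⊆ p⊆q) (p≢q ∘ cong (outside ∷_)))
⊆∧≢⇒⊂ {p = outside ∷ p} {inside ∷ q}  p⊆q _   = out⊂in (drop-∷-⊆ p⊆q)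
⊆∧≢⇒⊂ {p = inside ∷ p}  {outside ∷ q} p⊆q _   with p⊆q here
... | ()
⊆∧≢⇒⊂ {p = inside ∷ p}  {inside ∷ q}  p⊆q p≢q = s⊂s (⊆∧≢⇒⊂ (drop-∷-⊆ p⊆q) (p≢q ∘ cong (inside ∷_)))

¬⊥⊂⇒≡⊥ : ∀ {n} {p : Subset n} → ¬ (⊥ ⊂ p) → p ≡ ⊥
¬⊥⊂⇒≡⊥ ¬⊥⊂p = Empty-unique (λ (x , x∈p) → ¬⊥⊂p (⊥⊆ , x , x∈p , ∉⊥))

module Coloured {N} (c : Colouring N) where

  _⊂[_]_ : Subset N → Fin 2 → Subset N → Set
  p ⊂[ i ] q = p ⊂ q × c p q ≡ i

  _⊂[_]?_ : ∀ p i q → Dec (p ⊂[ i ] q)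
  p ⊂[ i ]? q = p ⊂? q ×-dec c p q ≟ i

  InStar : ℕ → Fin 2 → Subset N → Set
  InStar m i q = Σ (Fin m → Subset N) λ e → Injective _≡_ _≡_ e × (∀ j → e j ⊂[ i ] q)

  OutStar : ℕ → Fin 2 → Subset N → Set
  OutStar m i p = Σ (Fin m → Subset N) λ e → Injective _≡_ _≡_ e × (∀ j → p ⊂[ i ] e j)

  in-star⇒cap-copy : ∀ {m i q} → InStar m i q → Copy (cap m) c i
  in-star⇒cap-copy {m} {i} {q} (e , e-injective , e⊂q) = f , f-injective , f-monotone , f-edges
    where
    f : CapV m → Subset N
    f top     = q
    f (bot j) = e j
    f-injective : Injective _≡_ _≡_ f
    f-injective {top}   {top}   _  = refl
    f-injective {top}   {bot k} eq = contradiction (proj₁ (e⊂q k)) (⊂-irref (sym eq))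
    f-injective {bot j} {top}   eq = contradiction (proj₁ (e⊂q j)) (⊂-irref eq)
    f-injective {bot j} {bot k} eq = cong bot (e-injective eq)
    f-monotone : ∀ x y → capRel x y → f x ⊆ f y
    f-monotone (bot j) top     _ = proj₁ (proj₁ (e⊂q j))
    f-monotone top     _       ()
    f-monotone (bot _) (bot _) ()
    f-edges : ∀ x y → capRel x y → c (f x) (f y) ≡ i
    f-edges (bot j) top     _ = proj₂ (e⊂q j)
    f-edges top     _       ()
    f-edges (bot _) (bot _) ()

  cap-copy⇒in-star : ∀ {m i} → Copy (cap m) c i → Σ (Subset N) (InStar m i)
  cap-copy⇒in-star (f , f-injective , f-monotone , f-edges) =
    f top , f ∘ bot , bot-injective , λ j →
      ⊆∧≢⇒⊂ (f-monotone (bot j) top _) (λ eq → bot≢top (f-injective eq)) , f-edges (bot j) top _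
    where
    bot-injective : Injective _≡_ _≡_ (f ∘ bot)
    bot-injective eq with f-injective eq
    ... | refl = refl
    bot≢top : ∀ {j} → bot j ≢ top
    bot≢top ()

  out-star⇒cup-copy : ∀ {m i p} → OutStar m i p → Copy (cup m) c i
  out-star⇒cup-copy {m} {i} {p} (e , e-injective , p⊂e) = f , f-injective , f-monotone , f-edges
    where
    f : CupV m → Subset N
    f low    = p
    f (up j) = e j
    f-injective : Injective _≡_ _≡_ f
    f-injective {low}  {low}  _  = refl
    f-injective {low}  {up k} eq = contradiction (proj₁ (p⊂e k)) (⊂-irref eq)
    f-injective {up j} {low}  eq = contradiction (proj₁ (p⊂e j)) (⊂-irref (sym eq))
    f-injective {up j} {up k} eq = cong up (e-injective eq)
    f-monotone : ∀ x y → cupRel x y → f x ⊆ f y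
    f-monotone low    (up j) _ = proj₁ (proj₁ (p⊂e j))
    f-monotone low    low    ()
    f-monotone (up _) _      ()
    f-edges : ∀ x y → cupRel x y → c (f x) (f y) ≡ i
    f-edges low    (up j) _ = proj₂ (p⊂e j)
    f-edges low    low    ()
    f-edges (up _) _      ()

  diamond-copy : ∀ {m i p q} → p ⊂ q → (e : Fin m → Subset N) → Injective _≡_ _≡_ e →
                 (∀ j → p ⊂[ i ] e j) → (∀ j → e j ⊂[ i ] q) → Copy (diamond m) c i
  diamond-copy {m} {i} {p} {q} p⊂q e e-injective p⊂e e⊂q = f , f-injective , f-monotone , f-edges
    where
    f : DiaV m → Subset N
    f dbot     = p
    f (dmid j) = e j
    f dtop     = q
    f-injective : Injective _≡_ _≡_ f
    f-injective {dbot}   {dbot}   _  = refl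
    f-injective {dbot}   {dmid k} eq = contradiction (proj₁ (p⊂e k)) (⊂-irref eq)
    f-injective {dbot}   {dtop}   eq = contradiction p⊂q (⊂-irref eq)
    f-injective {dmid j} {dbot}   eq = contradiction (proj₁ (p⊂e j)) (⊂-irref (sym eq))
    f-injective {dmid j} {dmid k} eq = cong dmid (e-injective eq)
    f-injective {dmid j} {dtop}   eq = contradiction (proj₁ (e⊂q j)) (⊂-irref eq)
    f-injective {dtop}   {dbot}   eq = contradiction p⊂q (⊂-irref (sym eq))
    f-injective {dtop}   {dmid k} eq = contradiction (proj₁ (e⊂q k)) (⊂-irref (sym eq))
    f-injective {dtop}   {dtop}   _  = refl
    f-monotone : ∀ x y → diaOrd x y → f x ⊆ f y
    f-monotone dbot     (dmid j) _ = proj₁ (proj₁ (p⊂e j))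
    f-monotone (dmid j) dtop     _ = proj₁ (proj₁ (e⊂q j))
    f-monotone dbot     dtop     _ = proj₁ p⊂q
    f-monotone dbot     dbot     ()
    f-monotone (dmid _) dbot     ()
    f-monotone (dmid _) (dmid _) ()
    f-monotone dtop     _        ()
    f-edges : ∀ x y → diaEdge x y → c (f x) (f y) ≡ i
    f-edges dbot     (dmid j) _ = proj₂ (p⊂e j)
    f-edges (dmid j) dtop     _ = proj₂ (e⊂q j)
    f-edges dbot     dbot     ()
    f-edges dbot     dtop     ()
    f-edges (dmid _) dbot     ()
    f-edges (dmid _) (dmid _) ()
    f-edges dtop     _        ()

  inDegree : Fin 2 → Subset N → ℕ
  inDegree i q = count (_⊂[ i ]? q) (subsets N)

  outDegree : Fin 2 → Subset N → ℕ
  outDegree i p = count (p ⊂[ i ]?_) (subsets N)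

  inDegree⇒in-star : ∀ {m i q} → m ≤ inDegree i q → InStar m i q
  inDegree⇒in-star {i = i} {q} = count⇒injection (_⊂[ i ]? q) (subsets-unique N)

  outDegree⇒out-star : ∀ {m i p} → m ≤ outDegree i p → OutStar m i p
  outDegree⇒out-star {i = i} {p} = count⇒injection (p ⊂[ i ]?_) (subsets-unique N)

  inDegree-⊥ : ∀ i → inDegree i ⊥ ≡ 0
  inDegree-⊥ i = count-none (_⊂[ i ]? ⊥) (subsets N) (λ { p ((_ , _ , x∈⊥ , _) , _) → ∉⊥ x∈⊥ })

  ∑-degrees : ∑ (subsets N) (inDegree zero) + ∑ (subsets N) (outDegree (suc zero)) + 2 ^ N ≡ 3 ^ N
  ∑-degrees = begin
    ∑ (subsets N) (inDegree zero) + ∑ (subsets N) (outDegree (suc zero)) + 2 ^ N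
      ≡⟨ cong (λ t → ∑ (subsets N) (inDegree zero) + t + 2 ^ N)
              (∑-comm (subsets N) (subsets N) (λ q p → χ (p ⊂[ suc zero ]? q))) ⟨
    ∑ (subsets N) (inDegree zero) + ∑ (subsets N) (inDegree (suc zero)) + 2 ^ N
      ≡⟨ cong (_+ 2 ^ N) (∑-distrib-+ (subsets N) (inDegree zero) (inDegree (suc zero))) ⟨
    ∑ (subsets N) (λ q → inDegree zero q + inDegree (suc zero) q) + 2 ^ N
      ≡⟨ cong (_+ 2 ^ N) (∑-cong (subsets N) (λ q → count-by-colour (_⊂? q) (λ p → c p q) (subsets N))) ⟨
    ∑ (subsets N) (λ q → count (_⊂? q) (subsets N)) + 2 ^ N
      ≡⟨ ∑-count-⊂ N ⟩
    3 ^ N ∎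
    where open ≡-Reasoning

  bounded-degrees⇒3^N+k≤[1+k+u]*2^N : ∀ {k u} →
    All (λ q → inDegree zero q ≤ k) (subsets N) → All (λ p → outDegree (suc zero) p ≤ u) (subsets N) →
    3 ^ N + k ≤ suc (k + u) * 2 ^ N
  bounded-degrees⇒3^N+k≤[1+k+u]*2^N {k} {u} in≤k out≤u = begin
    3 ^ N + k
      ≡⟨ cong (_+ k) ∑-degrees ⟨
    ∑ (subsets N) (inDegree zero) + ∑ (subsets N) (outDegree (suc zero)) + 2 ^ N + k
      ≡⟨ solve 4 (λ a b d x → a :+ b :+ d :+ x := d :+ ((a :+ x) :+ b)) refl
               (∑ (subsets N) (inDegree zero)) (∑ (subsets N) (outDegree (suc zero))) (2 ^ N) k ⟩
    2 ^ N + ((∑ (subsets N) (inDegree zero) + k) + ∑ (subsets N) (outDegree (suc zero)))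
      ≤⟨ +-monoʳ-≤ (2 ^ N) (+-mono-≤ (∑-≤-vanishing (∈-subsets ⊥) (inDegree-⊥ zero) in≤k) (∑-≤ out≤u)) ⟩
    2 ^ N + (k * length (subsets N) + u * length (subsets N))
      ≡⟨ cong (λ l → 2 ^ N + (k * l + u * l)) (length-subsets N) ⟩
    2 ^ N + (k * 2 ^ N + u * 2 ^ N)
      ≡⟨ cong (2 ^ N +_) (*-distribʳ-+ (2 ^ N) k u) ⟨
    suc (k + u) * 2 ^ N ∎
    where open ≤-Reasoning

  cap-or-cup : ∀ {k u} → 0 < k → suc (k + u) * 2 ^ N ≤ 3 ^ N →
               Copy (cap (suc k)) c zero ⊎ Copy (cup (suc u)) c (suc zero)
  cap-or-cup {k} {u} 0<k bound with All.all? (λ q → inDegree zero q ≤? k) (subsets N)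
  ... | no ¬in≤k =
    let q , k<in = ¬All≤⇒∃> (inDegree zero) k (subsets N) ¬in≤k
    in inj₁ (in-star⇒cap-copy (inDegree⇒in-star {q = q} k<in))
  ... | yes in≤k with All.all? (λ p → outDegree (suc zero) p ≤? u) (subsets N)
  ...   | no ¬out≤u =
    let p , u<out = ¬All≤⇒∃> (outDegree (suc zero)) u (subsets N) ¬out≤u
    in inj₂ (out-star⇒cup-copy (outDegree⇒out-star {p = p} u<out))
  ...   | yes out≤u = contradiction bound (<⇒≱ (begin-strict
    3 ^ N                 <⟨ m<m+n (3 ^ N) 0<k ⟩
    3 ^ N + k             ≤⟨ bounded-degrees⇒3^N+k≤[1+k+u]*2^N in≤k out≤u ⟩
    suc (k + u) * 2 ^ N   ∎))
    where open ≤-Reasoning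

  module _ {m} (x : Fin m → Subset N) where

    #red #blue #empty : ℕ
    #red    = count (λ j → ⊥ ⊂[ zero ]? x j) (allFin m)
    #blue   = count (λ j → ⊥ ⊂[ suc zero ]? x j) (allFin m)
    #empty  = count (∁? (λ j → ⊥ ⊂? x j)) (allFin m)

    #red+#blue+#empty≡m : #red + #blue + #empty ≡ m
    #red+#blue+#empty≡m = begin
      #red + #blue + #empty
        ≡⟨ cong (_+ #empty) (count-by-colour (λ j → ⊥ ⊂? x j) (λ j → c ⊥ (x j)) (allFin m)) ⟨
      count (λ j → ⊥ ⊂? x j) (allFin m) + #empty
        ≡⟨ count+count-∁ (λ j → ⊥ ⊂? x j) (allFin m) ⟩
      length (allFin m)
        ≡⟨ length-tabulate (λ j → j) ⟩
      m ∎
      where open ≡-Reasoning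

    module _ (x-injective : Injective _≡_ _≡_ x) where

      #empty≤1 : #empty ≤ 1
      #empty≤1 = count≤1 (∁? (λ j → ⊥ ⊂? x j)) (Unique.allFin⁺ m)
                   (λ ¬⊥⊂xj ¬⊥⊂xk → x-injective (trans (¬⊥⊂⇒≡⊥ ¬⊥⊂xj) (sym (¬⊥⊂⇒≡⊥ ¬⊥⊂xk))))

      select : ∀ {k i} → k ≤ count (λ j → ⊥ ⊂[ i ]? x j) (allFin m) →
               Σ (Fin k → Fin m) λ e → Injective _≡_ _≡_ (x ∘ e) × (∀ j → ⊥ ⊂[ i ] x (e j))
      select {i = i} k≤count =
        let e , e-injective , ⊥⊂xe = count⇒injection (λ j → ⊥ ⊂[ i ]? x j) (Unique.allFin⁺ m) k≤count
        in e , Composition.injective _≡_ _≡_ _≡_ e-injective x-injective , ⊥⊂xe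


  in-star⇒diamond-or-cup : ∀ {s r q} → InStar (s + r) zero q →
                           Copy (diamond s) c zero ⊎ Copy (cup r) c (suc zero)
  in-star⇒diamond-or-cup {s} {r} {q} (x , x-injective , x⊂q) with r ≤? #blue x
  ... | yes r≤#blue =
    let e , xe-injective , ⊥⊂xe = select x x-injective r≤#blue
    in inj₂ (out-star⇒cup-copy (x ∘ e , xe-injective , ⊥⊂xe))
  ... | no r≰#blue with s ≤? #red x
  ...   | yes s≤#red =
    let e , xe-injective , ⊥⊂xe = select x x-injective s≤#red
    in inj₁ (diamond-copy ⊥⊂q (x ∘ e) xe-injective ⊥⊂xe (x⊂q ∘ e))
    where
    -- r ≰ #blue forces 0 < r, so the cap has a bottom to put between ⊥ and q.
    ⊥⊂q : ⊥ ⊂ q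
    ⊥⊂q = ⊆-⊂-trans ⊥⊆ (proj₁ (x⊂q (fromℕ< (m<m+n s (≤-trans (s≤s z≤n) (≰⇒> r≰#blue))))))
  ...   | no s≰#red = contradiction (#red+#blue+#empty≡m x) (<⇒≢ (begin-strict
    #red x + #blue x + #empty x    ≤⟨ +-monoʳ-≤ (#red x + #blue x) (#empty≤1 x x-injective) ⟩
    #red x + #blue x + 1           ≡⟨ +-comm (#red x + #blue x) 1 ⟩
    suc (#red x + #blue x)         <⟨ s<s (+-monoʳ-< (#red x) (n<1+n (#blue x))) ⟩
    suc (#red x) + suc (#blue x)   ≤⟨ +-mono-≤ (≰⇒> s≰#red) (≰⇒> r≰#blue) ⟩
    s + r                          ∎))
    where open ≤-Reasoning

cap⇒diamond : ∀ {N} s r → Arrows (cap (s + r)) (cup r) N → Arrows (diamond s) (cup r) N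
cap⇒diamond s r arrows c = [ in-star⇒diamond-or-cup ∘ proj₂ ∘ cap-copy⇒in-star , inj₂ ]′ (arrows c)
  where open Coloured c

cap-cup-arrows : ∀ {k u L} → 0 < k → suc (k + u) * 2 ^ L ≤ 3 ^ L → Arrows (cap (suc k)) (cup (suc u)) L
cap-cup-arrows 0<k bound c = Coloured.cap-or-cup c 0<k bound

theorem3p11 : (s r : ℕ) → 2 ≤ s → 2 ≤ r →
    ((N : ℕ) → Arrows (cap (s + r)) (cup r) N →
       Σ ℕ λ N′ → N′ ≤ N × Arrows (diamond s) (cup r) N′)
    × ((L : ℕ) → IsCeilLog32 (2 * r + s ∸ 1) L →
       Σ ℕ λ N → N ≤ L × Arrows (cap (s + r)) (cup r) N)
theorem3p11 (suc s) (suc r) (s≤s _) (s≤s _) =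
  (λ N arrows → N , ≤-refl , cap⇒diamond (suc s) (suc r) arrows) ,
  (λ L (bound , _) →
     L , ≤-refl , cap-cup-arrows 0<s+[1+r] (subst (λ m → m * 2 ^ L ≤ 3 ^ L) 2r+s∸1≡1+k+u bound))
  where
  0<s+[1+r] : 0 < s + suc r
  0<s+[1+r] = <-≤-trans z<s (m≤n+m (suc r) s)
  2r+s∸1≡1+k+u : 2 * suc r + suc s ∸ 1 ≡ suc (s + suc r + r)
  2r+s∸1≡1+k+u = solve 2 (λ s r → r :+ (con 1 :+ r :+ con 0) :+ (con 1 :+ s)
                                 := con 1 :+ (s :+ (con 1 :+ r) :+ r)) refl s r
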